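{- Let $G$ be a formula, let $\mathcal T$ be a $\mathbf{GBU}(G)$-tree and let $\tau$ be its root sequent. Then the height of $\mathcal T$ is $O(|\tau|^2)$, where $|\tau|$ is the number of logical symbols occurring in $\tau$.
   Context: Formulas are built from a countably infinite set of propositional variables and $\bot$ using $\land,\lor,\supset$. For a formula $G$, $\mathrm{Sl}(G)$ and $\mathrm{Sr}(G)$ are the smallest subsets of the subformulas of $G$ with: $G\in\mathrm{Sr}(G)$; $A\land B$ or $A\lor B$ in $\mathrm{Sl}(G)$ (resp. $\mathrm{Sr}(G)$) implies $A,B$ in $\mathrm{Sl}(G)$ (resp. $\mathrm{Sr}(G)$); $A\supset B\in\mathrm{Sl}(G)$ implies $B\in\mathrm{Sl}(G)$, $A\in\mathrm{Sr}(G)$; $A\supset B\in\mathrm{Sr}(G)$ implies $B\in\mathrm{Sr}(G)$, $A\in\mathrm{Sl}(G)$. $\mathrm{Cl}(\Gamma)$ is the smallest set containing $\Gamma$ such that if $X,Y\in\mathrm{Cl}(\Gamma)$ and $A$ is any formula then $X\land Y,A\lor X,X\lor A,A\supset X\in\mathrm{Cl}(\Gamma)$. Commas denote union. $\mathbf{GBU}(G)$: sequents regular $\Psi\Rightarrow_g A$ and irregular $\Psi\rightarrow_g A$ with $\Psi\subseteq\mathrm{Sl}(G)$, $A\in\mathrm{Sr}(G)$ (all sequents in rules satisfy this). Rules ($k\in\{1,2\}$): axioms $A,\Psi\Rightarrow_g A$, $\bot,\Psi\Rightarrow_g C$, $A,\Psi\rightarrow_g A$; $L\land$: $A,B,\Psi\Rightarrow_g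 C/A\land B,\Psi\Rightarrow_g C$; $R\land$: $\Psi\Rightarrow_g A$, $\Psi\Rightarrow_g B/\Psi\Rightarrow_g A\land B$ and likewise with $\rightarrow_g$ throughout; $L\lor$: $A,\Psi\Rightarrow_g C$, $B,\Psi\Rightarrow_g C/A\lor B,\Psi\Rightarrow_g C$; $R\lor_k$: $\Psi\rightarrow_g C_k/\Psi\Rightarrow_g C_1\lor C_2$ and $\Psi\rightarrow_g C_k/\Psi\rightarrow_g C_1\lor C_2$; $L\supset$: $A\supset B,\Psi\rightarrow_g A$, $B,\Psi\Rightarrow_g C/A\supset B,\Psi\Rightarrow_g C$; $\supset R_\in$: $\Psi\Rightarrow_g B/\Psi\Rightarrow_g A\supset B$ and $\Psi\rightarrow_g B/\Psi\rightarrow_g A\supset B$, if $A\in\mathrm{Cl}(\Psi)$; $\supset R_{\notin}$: $A,\Psi\Rightarrow_g B/\Psi\Rightarrow_g A\supset B$ and $A,\Psi\Rightarrow_g B/\Psi\rightarrow_g A\supset B$, if $A\notin\mathrm{Cl}(\Psi)$. A $\mathbf{GBU}(G)$-tree is a finite tree of $\mathbf{GBU}(G)$-sequents in which every internal node is the conclusion of a rule instance whose premises are its children (leaves need not be axioms); its height is the number of edges of a longest root-to-leaf path. -}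

module Defs where

open import Data.Nat using (ℕ; zero; suc; _+_; _⊔_)
open import Data.List using (List; []; _∷_; map)
open import Data.Nat.ListAction using (sum)
open import Data.List.Membership.Propositional using (_∈_)
open import Data.List.Relation.Unary.All using (All; []; _∷_)
open import Data.List.Relation.Unary.Unique.Propositional using (Unique)
open import Data.Product using (_×_)
open import Relation.Nullary using (¬_)

infixr 6 _∧_
infixr 5 _∨_
infixr 4 _⊃_

data Formula : Set where
  var : ℕ → Formula
  ⊥ₗ  : Formula
  _∧_ : Formula → Formula → Formula
  _∨_ : Formula → Formula → Formula
  _⊃_ : Formula → Formula → Formula

size : Formula → ℕ
size (var _) = 0
size ⊥ₗ = 1
size (A ∧ B) = suc (size A + size B)
size (A ∨ B) = suc (size A + size B)
size (A ⊃ B) = suc (size A + size B)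

mutual
  data Sl (G : Formula) : Formula → Set where
    sl∧ˡ : ∀ {A B} → Sl G (A ∧ B) → Sl G A
    sl∧ʳ : ∀ {A B} → Sl G (A ∧ B) → Sl G B
    sl∨ˡ : ∀ {A B} → Sl G (A ∨ B) → Sl G A
    sl∨ʳ : ∀ {A B} → Sl G (A ∨ B) → Sl G B
    sl⊃  : ∀ {A B} → Sl G (A ⊃ B) → Sl G B
    sr⊃  : ∀ {A B} → Sr G (A ⊃ B) → Sl G A

  data Sr (G : Formula) : Formula → Set where
    root : Sr G G
    sr∧ˡ : ∀ {A B} → Sr G (A ∧ B) → Sr G A
    sr∧ʳ : ∀ {A B} → Sr G (A ∧ B) → Sr G B
    sr∨ˡ : ∀ {A B} → Sr G (A ∨ B) → Sr G A
    sr∨ʳ : ∀ {A B} → Sr G (A ∨ B) → Sr G B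
    sr⊃  : ∀ {A B} → Sr G (A ⊃ B) → Sr G B
    sl⊃  : ∀ {A B} → Sl G (A ⊃ B) → Sr G A

data Cl (Γ : List Formula) : Formula → Set where
  base : ∀ {X} → X ∈ Γ → Cl Γ X
  cl∧  : ∀ {X Y} → Cl Γ X → Cl Γ Y → Cl Γ (X ∧ Y)
  cl∨ˡ : ∀ {X} A → Cl Γ X → Cl Γ (A ∨ X)
  cl∨ʳ : ∀ {X} A → Cl Γ X → Cl Γ (X ∨ A)
  cl⊃  : ∀ {X} A → Cl Γ X → Cl Γ (A ⊃ X)

-- Finite sets of formulas are represented by lists; equality of the
-- represented sets:
infix 4 _≈_
_≈_ : List Formula → List Formula → Set
Γ ≈ Δ = ∀ x → (x ∈ Γ → x ∈ Δ) × (x ∈ Δ → x ∈ Γ)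

-- regular (⇒g) or irregular (→g) sequent arrow
data Arrow : Set where
  reg irr : Arrow

record Seq : Set where
  constructor seq
  field
    ant : List Formula
    arr : Arrow
    rhs : Formula
open Seq public

GSeq : Formula → Seq → Set
GSeq G s = Unique (ant s) × All (Sl G) (ant s) × Sr G (rhs s)

∣_∣ : Seq → ℕ
∣ s ∣ = sum (map size (ant s)) + size (rhs s)

-- Non-axiom rule instances of GBU: Rule premises conclusion.
-- In "P, Ψ" the principal formula P of a left rule is not in Ψ.
data Rule : List Seq → Seq → Set where
  L∧ : ∀ {Ψ Δ Δ′ A B C} → ¬ ((A ∧ B) ∈ Ψ) → Δ ≈ (A ∧ B) ∷ Ψ → Δ′ ≈ A ∷ B ∷ Ψ →
       Rule (seq Δ′ reg C ∷ []) (seq Δ reg C)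
  R∧ : ∀ {Δ Δ₁ Δ₂ A B} a → Δ₁ ≈ Δ → Δ₂ ≈ Δ →
       Rule (seq Δ₁ a A ∷ seq Δ₂ a B ∷ []) (seq Δ a (A ∧ B))
  L∨ : ∀ {Ψ Δ Δ₁ Δ₂ A B C} → ¬ ((A ∨ B) ∈ Ψ) → Δ ≈ (A ∨ B) ∷ Ψ →
       Δ₁ ≈ A ∷ Ψ → Δ₂ ≈ B ∷ Ψ →
       Rule (seq Δ₁ reg C ∷ seq Δ₂ reg C ∷ []) (seq Δ reg C)
  R∨₁ : ∀ {Δ Δ′ C₁ C₂} a → Δ′ ≈ Δ →
       Rule (seq Δ′ irr C₁ ∷ []) (seq Δ a (C₁ ∨ C₂))
  R∨₂ : ∀ {Δ Δ′ C₁ C₂} a → Δ′ ≈ Δ →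
       Rule (seq Δ′ irr C₂ ∷ []) (seq Δ a (C₁ ∨ C₂))
  L⊃ : ∀ {Ψ Δ Δ₁ Δ₂ A B C} → ¬ ((A ⊃ B) ∈ Ψ) → Δ ≈ (A ⊃ B) ∷ Ψ →
       Δ₁ ≈ (A ⊃ B) ∷ Ψ → Δ₂ ≈ B ∷ Ψ →
       Rule (seq Δ₁ irr A ∷ seq Δ₂ reg C ∷ []) (seq Δ reg C)
  ⊃R∈ : ∀ {Δ Δ′ A B} a → Cl Δ A → Δ′ ≈ Δ →
       Rule (seq Δ′ a B ∷ []) (seq Δ a (A ⊃ B))
  ⊃R∉ : ∀ {Δ Δ′ A B} a → ¬ Cl Δ A → Δ′ ≈ A ∷ Δ →
       Rule (seq Δ′ reg B ∷ []) (seq Δ a (A ⊃ B))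

-- GBU(G)-trees with root sequent s. Leaves need not be axioms; every
-- internal node is the conclusion of a rule instance with its children
-- as premises (all rules above have ≥ 1 premise).
data Tree (G : Formula) : Seq → Set where
  leaf : ∀ {s} → GSeq G s → Tree G s
  node : ∀ {s ps} → GSeq G s → Rule ps s → All (Tree G) ps → Tree G s

-- height = number of edges of a longest root-to-leaf path
mutual
  height : ∀ {G s} → Tree G s → ℕ
  height (leaf _) = 0
  height (node _ _ ts) = suc (heights ts)

  heights : ∀ {G ps} → All (Tree G) ps → ℕ
  heights [] = 0
  heights (t ∷ ts) = height t ⊔ heights ts

module Submission where

-- Every rule passes from its conclusion to premises of strictly smaller rank, so the height of a
-- tree is at most the rank of its root. Let U be the antecedents of the implications occurring in
-- the root τ and N = |τ|; every formula of the tree is a subformula of a root formula, so it has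
-- size at most N and the antecedents of its implications lie in U. The rank of a sequent with
-- antecedent Ψ is a weight, essentially its size, plus 2N + 1 times the number of formulas of U
-- outside Cl(Ψ). Every rule except ⊃R∉ lowers the weight and can only enlarge Cl(Ψ); ⊃R∉ raises
-- the weight by at most 2N but adds to Ψ some A ∈ U with A ∉ Cl(Ψ). The rank of the root is at
-- most (2N + 1)(N + 1).

open import Defs
open import Algebra.Properties.CommutativeSemigroup using (x∙yz≈y∙xz)
open import Data.Empty using (⊥-elim)
open import Data.List using (List; []; _∷_; _++_; map; concatMap; length; filter)
open import Data.List.Properties using (map-++; length-++; length-filter)
open import Data.List.Membership.Propositional using (_∈_; _∉_; _─_)
open import Data.List.Membership.Propositional.Properties using (∈-++⁺ˡ; ∈-++⁺ʳ; ∈-++⁻; ∈-concatMap⁺)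
import Data.List.Membership.DecPropositional as DecMembership
open import Data.List.Relation.Binary.Subset.Propositional using (_⊆_)
open import Data.List.Relation.Binary.Sublist.Propositional using (⊆-refl)
open import Data.List.Relation.Binary.Sublist.Propositional.Properties using (filter⁺)
open import Data.List.Relation.Binary.Sublist.Heterogeneous.Properties using (length-mono-≤)
open import Data.List.Relation.Unary.All as All using (All; []; _∷_)
open import Data.List.Relation.Unary.All.Properties using (anti-mono; ++⁺)
open import Data.List.Relation.Unary.AllPairs using (_∷_)
open import Data.List.Relation.Unary.Any as Any using (here; there)
open import Data.List.Relation.Unary.Unique.Propositional using (Unique)
open import Data.Nat as ℕ using (ℕ; zero; suc; _+_; _*_; _^_; _≤_; _<_; z≤n; s≤s)
open import Data.Nat.ListAction using (sum)
open import Data.Nat.ListAction.Properties using (sum-++)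
open import Data.Nat.Properties hiding (_≟_)
open import Data.Nat.Tactic.RingSolver using (solve-∀)
open import Data.Product using (∃-syntax; _×_; _,_; proj₁; proj₂; uncurry)
open import Data.Sum using (inj₁; inj₂; [_,_]′)
open import Data.Unit using (⊤)
open import Function using (_∘_)
open import Relation.Binary.Definitions using (DecidableEquality)
open import Relation.Binary.PropositionalEquality using (_≡_; _≢_; refl; sym; cong; cong₂; module ≡-Reasoning)
open import Relation.Nullary using (Dec; ¬_; yes; no)
open import Relation.Nullary.Decidable using (map′; ¬?; _×-dec_; _⊎-dec_)
open import Relation.Unary using (Pred; Decidable)

infix 3 _≟_
_≟_ : DecidableEquality Formula
var m ≟ var n = map′ (cong var) (λ { refl → refl }) (m ℕ.≟ n)
var _ ≟ ⊥ₗ = no λ ()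
var _ ≟ _ ∧ _ = no λ ()
var _ ≟ _ ∨ _ = no λ ()
var _ ≟ _ ⊃ _ = no λ ()
⊥ₗ ≟ var _ = no λ ()
⊥ₗ ≟ ⊥ₗ = yes refl
⊥ₗ ≟ _ ∧ _ = no λ ()
⊥ₗ ≟ _ ∨ _ = no λ ()
⊥ₗ ≟ _ ⊃ _ = no λ ()
A ∧ B ≟ var _ = no λ ()
A ∧ B ≟ ⊥ₗ = no λ ()
A ∧ B ≟ C ∧ D = map′ (uncurry (cong₂ _∧_)) (λ { refl → refl , refl }) (A ≟ C ×-dec B ≟ D)
A ∧ B ≟ _ ∨ _ = no λ ()
A ∧ B ≟ _ ⊃ _ = no λ ()
A ∨ B ≟ var _ = no λ ()
A ∨ B ≟ ⊥ₗ = no λ ()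
A ∨ B ≟ _ ∧ _ = no λ ()
A ∨ B ≟ C ∨ D = map′ (uncurry (cong₂ _∨_)) (λ { refl → refl , refl }) (A ≟ C ×-dec B ≟ D)
A ∨ B ≟ _ ⊃ _ = no λ ()
A ⊃ B ≟ var _ = no λ ()
A ⊃ B ≟ ⊥ₗ = no λ ()
A ⊃ B ≟ _ ∧ _ = no λ ()
A ⊃ B ≟ _ ∨ _ = no λ ()
A ⊃ B ≟ C ⊃ D = map′ (uncurry (cong₂ _⊃_)) (λ { refl → refl , refl }) (A ≟ C ×-dec B ≟ D)

open DecMembership _≟_ using (_∈?_)

mutual
  Cl? : ∀ Γ → Decidable (Cl Γ)
  Cl? Γ X with X ∈? Γ
  ... | yes X∈Γ = yes (base X∈Γ)
  ... | no  X∉Γ = Cl-compound? X∉Γ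

  Cl-compound? : ∀ {Γ X} → X ∉ Γ → Dec (Cl Γ X)
  Cl-compound? {X = var _} X∉Γ = no λ { (base X∈Γ) → X∉Γ X∈Γ }
  Cl-compound? {X = ⊥ₗ} X∉Γ = no λ { (base X∈Γ) → X∉Γ X∈Γ }
  Cl-compound? {Γ} {A ∧ B} X∉Γ =
    map′ (uncurry cl∧) (λ { (base X∈Γ) → ⊥-elim (X∉Γ X∈Γ) ; (cl∧ a b) → a , b })
         (Cl? Γ A ×-dec Cl? Γ B)
  Cl-compound? {Γ} {A ∨ B} X∉Γ =
    map′ [ cl∨ʳ B , cl∨ˡ A ]′
         (λ { (base X∈Γ) → ⊥-elim (X∉Γ X∈Γ) ; (cl∨ʳ _ a) → inj₁ a ; (cl∨ˡ _ b) → inj₂ b })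
         (Cl? Γ A ⊎-dec Cl? Γ B)
  Cl-compound? {Γ} {A ⊃ B} X∉Γ =
    map′ (cl⊃ A) (λ { (base X∈Γ) → ⊥-elim (X∉Γ X∈Γ) ; (cl⊃ _ b) → b }) (Cl? Γ B)

Cl-mono : ∀ {Γ Δ} → (∀ {X} → X ∈ Γ → Cl Δ X) → ∀ {X} → Cl Γ X → Cl Δ X
Cl-mono Γ⊆ClΔ (base X∈Γ) = Γ⊆ClΔ X∈Γ
Cl-mono Γ⊆ClΔ (cl∧ a b)  = cl∧ (Cl-mono Γ⊆ClΔ a) (Cl-mono Γ⊆ClΔ b)
Cl-mono Γ⊆ClΔ (cl∨ˡ A b) = cl∨ˡ A (Cl-mono Γ⊆ClΔ b)
Cl-mono Γ⊆ClΔ (cl∨ʳ B a) = cl∨ʳ B (Cl-mono Γ⊆ClΔ a)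
Cl-mono Γ⊆ClΔ (cl⊃ A b)  = cl⊃ A (Cl-mono Γ⊆ClΔ b)

length-filter-mono : ∀ {a p q} {A : Set a} {P : Pred A p} {Q : Pred A q} (P? : Decidable P) (Q? : Decidable Q) →
                     (∀ {x} → P x → Q x) → ∀ xs → length (filter P? xs) ≤ length (filter Q? xs)
length-filter-mono P? Q? P⇒Q xs = length-mono-≤ (filter⁺ P? Q? (λ { refl → P⇒Q }) (⊆-refl {x = xs}))

length-filter-mono-< : ∀ {a p q} {A : Set a} {P : Pred A p} {Q : Pred A q} (P? : Decidable P) (Q? : Decidable Q) →
               (∀ {x} → P x → Q x) → ∀ {x xs} → x ∈ xs → ¬ P x → Q x →
               length (filter P? xs) < length (filter Q? xs)
length-filter-mono-< P? Q? P⇒Q {xs = y ∷ ys} (here refl) ¬Py Qy with P? y | Q? y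
... | yes Py | _      = ⊥-elim (¬Py Py)
... | no _   | no ¬Qy = ⊥-elim (¬Qy Qy)
... | no _   | yes _  = s≤s (length-filter-mono P? Q? P⇒Q ys)
length-filter-mono-< P? Q? P⇒Q {xs = y ∷ ys} (there x∈ys) ¬Px Qx
  with P? y | Q? y | length-filter-mono-< P? Q? P⇒Q x∈ys ¬Px Qx
... | yes Py | no ¬Qy | _  = ⊥-elim (¬Qy (P⇒Q Py))
... | yes _  | yes _  | ih = s≤s ih
... | no _   | yes _  | ih = m<n⇒m<1+n ih
... | no _   | no _   | ih = ih

module _ {a} {A : Set a} where

  ∈-─⁺ : ∀ {x y} {xs : List A} (x∈xs : x ∈ xs) → y ∈ xs → y ≢ x → y ∈ xs ─ x∈xs
  ∈-─⁺ (here refl) (here refl)  y≢x = ⊥-elim (y≢x refl)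
  ∈-─⁺ (here refl) (there y∈xs) y≢x = y∈xs
  ∈-─⁺ (there x∈xs) (here y≡z)  y≢x = here y≡z
  ∈-─⁺ (there x∈xs) (there y∈xs) y≢x = there (∈-─⁺ x∈xs y∈xs y≢x)

  sum-map-─ : ∀ (f : A → ℕ) {x xs} (x∈xs : x ∈ xs) →
              sum (map f xs) ≡ f x + sum (map f (xs ─ x∈xs))
  sum-map-─ f (here refl) = refl
  sum-map-─ f {x} {y ∷ xs} (there x∈xs) = begin
    f y + sum (map f xs)                       ≡⟨ cong (f y +_) (sum-map-─ f x∈xs) ⟩
    f y + (f x + sum (map f (xs ─ x∈xs)))     ≡⟨ x∙yz≈y∙xz +-commutativeSemigroup (f y) (f x) _ ⟩
    f x + (f y + sum (map f (xs ─ x∈xs)))     ∎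
    where open ≡-Reasoning

  ∈⇒≤sum-map : ∀ (f : A → ℕ) {x xs} → x ∈ xs → f x ≤ sum (map f xs)
  ∈⇒≤sum-map f x∈xs = ≤-trans (m≤m+n _ _) (≤-reflexive (sym (sum-map-─ f x∈xs)))

  sum-mono-⊆ : ∀ (f : A → ℕ) {xs ys : List A} → Unique xs → xs ⊆ ys →
               sum (map f xs) ≤ sum (map f ys)
  sum-mono-⊆ f {[]} _ _ = z≤n
  sum-mono-⊆ f {x ∷ xs} {ys} (x≢xs ∷ xs!) xs⊆ys = begin
    f x + sum (map f xs)               ≤⟨ +-monoʳ-≤ (f x) (sum-mono-⊆ f xs! xs⊆ys─x) ⟩
    f x + sum (map f (ys ─ x∈ys))     ≡⟨ sum-map-─ f x∈ys ⟨
    sum (map f ys)                     ∎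
    where
    open ≤-Reasoning
    x∈ys = xs⊆ys (here refl)
    xs⊆ys─x : xs ⊆ ys ─ x∈ys
    xs⊆ys─x y∈xs = ∈-─⁺ x∈ys (xs⊆ys (there y∈xs)) (All.lookup x≢xs y∈xs ∘ sym)

root-GSeq : ∀ {G s} → Tree G s → GSeq G s
root-GSeq (leaf g)     = g
root-GSeq (node g _ _) = g

module _ {G : Formula} {i} (Inv : Seq → Set i) (rank : Seq → ℕ)
         (descend : ∀ {ps s} → Rule ps s → All (GSeq G) ps → Inv s →
                    All (λ p → Inv p × rank p < rank s) ps) where

  mutual
    height≤rank : ∀ {s} (T : Tree G s) → Inv s → height T ≤ rank s
    height≤rank (leaf _) _ = z≤n
    height≤rank (node _ () [])
    height≤rank (node _ r ts@(_ ∷ _)) inv = heights< (positive children) children ts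
      where
      children = descend r (All.map root-GSeq ts) inv
      positive : ∀ {n p ps} → All (λ p → Inv p × rank p < n) (p ∷ ps) → 0 < n
      positive ((_ , p<n) ∷ _) = ≤-<-trans z≤n p<n

    heights< : ∀ {n ps} → 0 < n → All (λ p → Inv p × rank p < n) ps → (ts : All (Tree G) ps) →
               heights ts < n
    heights< 0<n [] [] = 0<n
    heights< 0<n ((inv , p<n) ∷ children) (t ∷ ts) =
      ⊔-lub (≤-<-trans (height≤rank t inv) p<n) (heights< 0<n children ts)

-- L⊃ moves the antecedent of a left implication to the right of an irregular premise, so it is
-- never decomposed on the left and does not count here.
leftSize : Formula → ℕ
leftSize (var _) = 0
leftSize ⊥ₗ      = 0
leftSize (A ∧ B) = suc (leftSize A + leftSize B)
leftSize (A ∨ B) = suc (leftSize A + leftSize B)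
leftSize (A ⊃ B) = suc (leftSize B)

leftSize≤size : ∀ F → leftSize F ≤ size F
leftSize≤size (var _) = z≤n
leftSize≤size ⊥ₗ      = z≤n
leftSize≤size (A ∧ B) = s≤s (+-mono-≤ (leftSize≤size A) (leftSize≤size B))
leftSize≤size (A ∨ B) = s≤s (+-mono-≤ (leftSize≤size A) (leftSize≤size B))
leftSize≤size (A ⊃ B) = s≤s (≤-trans (leftSize≤size B) (m≤n+m (size B) (size A)))

sum-leftSize≤sum-size : ∀ Γ → sum (map leftSize Γ) ≤ sum (map size Γ)
sum-leftSize≤sum-size []      = z≤n
sum-leftSize≤sum-size (F ∷ Γ) = +-mono-≤ (leftSize≤size F) (sum-leftSize≤sum-size Γ)

AntecedentsIn : List Formula → Formula → Set
AntecedentsIn U (var _) = ⊤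
AntecedentsIn U ⊥ₗ      = ⊤
AntecedentsIn U (A ∧ B) = AntecedentsIn U A × AntecedentsIn U B
AntecedentsIn U (A ∨ B) = AntecedentsIn U A × AntecedentsIn U B
AntecedentsIn U (A ⊃ B) = A ∈ U × AntecedentsIn U A × AntecedentsIn U B

antecedents : Formula → List Formula
antecedents (var _) = []
antecedents ⊥ₗ      = []
antecedents (A ∧ B) = antecedents A ++ antecedents B
antecedents (A ∨ B) = antecedents A ++ antecedents B
antecedents (A ⊃ B) = A ∷ antecedents A ++ antecedents B

AntecedentsIn-mono : ∀ {U V} → U ⊆ V → ∀ F → AntecedentsIn U F → AntecedentsIn V F
AntecedentsIn-mono U⊆V (var _) _ = _
AntecedentsIn-mono U⊆V ⊥ₗ      _ = _
AntecedentsIn-mono U⊆V (A ∧ B) (a , b) = AntecedentsIn-mono U⊆V A a , AntecedentsIn-mono U⊆V B b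
AntecedentsIn-mono U⊆V (A ∨ B) (a , b) = AntecedentsIn-mono U⊆V A a , AntecedentsIn-mono U⊆V B b
AntecedentsIn-mono U⊆V (A ⊃ B) (A∈U , a , b) =
  U⊆V A∈U , AntecedentsIn-mono U⊆V A a , AntecedentsIn-mono U⊆V B b

AntecedentsIn-antecedents : ∀ F → AntecedentsIn (antecedents F) F
AntecedentsIn-antecedents (var _) = _
AntecedentsIn-antecedents ⊥ₗ      = _
AntecedentsIn-antecedents (A ∧ B) =
  AntecedentsIn-mono ∈-++⁺ˡ A (AntecedentsIn-antecedents A) ,
  AntecedentsIn-mono (∈-++⁺ʳ (antecedents A)) B (AntecedentsIn-antecedents B)
AntecedentsIn-antecedents (A ∨ B) =
  AntecedentsIn-mono ∈-++⁺ˡ A (AntecedentsIn-antecedents A) ,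
  AntecedentsIn-mono (∈-++⁺ʳ (antecedents A)) B (AntecedentsIn-antecedents B)
AntecedentsIn-antecedents (A ⊃ B) =
  here refl ,
  AntecedentsIn-mono (there ∘ ∈-++⁺ˡ) A (AntecedentsIn-antecedents A) ,
  AntecedentsIn-mono (there ∘ ∈-++⁺ʳ (antecedents A)) B (AntecedentsIn-antecedents B)

length-antecedents-++ : ∀ A B → length (antecedents A ++ antecedents B) ≤ size A + size B

length-antecedents : ∀ F → length (antecedents F) ≤ size F
length-antecedents (var _) = z≤n
length-antecedents ⊥ₗ      = z≤n
length-antecedents (A ∧ B) = m≤n⇒m≤1+n (length-antecedents-++ A B)
length-antecedents (A ∨ B) = m≤n⇒m≤1+n (length-antecedents-++ A B)
length-antecedents (A ⊃ B) = s≤s (length-antecedents-++ A B)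

length-antecedents-++ A B =
  ≤-trans (≤-reflexive (length-++ (antecedents A))) (+-mono-≤ (length-antecedents A) (length-antecedents B))

length-concatMap-antecedents : ∀ Γ → length (concatMap antecedents Γ) ≤ sum (map size Γ)
length-concatMap-antecedents []      = z≤n
length-concatMap-antecedents (F ∷ Γ) =
  ≤-trans (≤-reflexive (length-++ (antecedents F)))
          (+-mono-≤ (length-antecedents F) (length-concatMap-antecedents Γ))

≈⇒⊆ : ∀ {Δ Γ} → Δ ≈ Γ → Δ ⊆ Γ
≈⇒⊆ Δ≈Γ {x} = proj₁ (Δ≈Γ x)

≈⇒⊇ : ∀ {Δ Γ} → Δ ≈ Γ → Γ ⊆ Δ
≈⇒⊇ Δ≈Γ {x} = proj₂ (Δ≈Γ x)

≈-trans-sym : ∀ {Δ Δ′ Γ} → Δ′ ≈ Γ → Δ ≈ Γ → Δ′ ≈ Δ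
≈-trans-sym Δ′≈Γ Δ≈Γ x = ≈⇒⊇ Δ≈Γ ∘ ≈⇒⊆ Δ′≈Γ , ≈⇒⊇ Δ′≈Γ ∘ ≈⇒⊆ Δ≈Γ

module Ranking (U : List Formula) (N : ℕ) where

  Admissible : Formula → Set
  Admissible F = AntecedentsIn U F × size F ≤ N

  AdmissibleSeq : Seq → Set
  AdmissibleSeq s = All Admissible (rhs s ∷ ant s)

  private
    size-split : ∀ {m n} → suc (m + n) ≤ N → m ≤ N × n ≤ N
    size-split {m} {n} m+n<N = ≤-trans (m≤m+n m n) (<⇒≤ m+n<N) , ≤-trans (m≤n+m n m) (<⇒≤ m+n<N)

  admissible-∧ : ∀ {A B} → Admissible (A ∧ B) → Admissible A × Admissible B
  admissible-∧ ((a , b) , A∧B≤N) = let (A≤N , B≤N) = size-split A∧B≤N in (a , A≤N) , (b , B≤N)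

  admissible-∨ : ∀ {A B} → Admissible (A ∨ B) → Admissible A × Admissible B
  admissible-∨ ((a , b) , A∨B≤N) = let (A≤N , B≤N) = size-split A∨B≤N in (a , A≤N) , (b , B≤N)

  admissible-⊃ : ∀ {A B} → Admissible (A ⊃ B) → Admissible A × Admissible B
  admissible-⊃ ((_ , a , b) , A⊃B≤N) = let (A≤N , B≤N) = size-split A⊃B≤N in (a , A≤N) , (b , B≤N)

  private
    ¬Cl? : ∀ Γ → Decidable (λ X → ¬ Cl Γ X)
    ¬Cl? Γ X = ¬? (Cl? Γ X)

    ¬Cl-antitone : ∀ {Γ Δ} → (∀ {X} → X ∈ Γ → Cl Δ X) → ∀ {X} → ¬ Cl Δ X → ¬ Cl Γ X
    ¬Cl-antitone Γ⊆ClΔ ¬ClΔX = ¬ClΔX ∘ Cl-mono Γ⊆ClΔ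

  missing : List Formula → ℕ
  missing Γ = length (filter (¬Cl? Γ) U)

  missing-antitone : ∀ {Γ Δ} → (∀ {X} → X ∈ Γ → Cl Δ X) → missing Δ ≤ missing Γ
  missing-antitone Γ⊆ClΔ = length-filter-mono (¬Cl? _) (¬Cl? _) (¬Cl-antitone Γ⊆ClΔ) U

  missing-< : ∀ {Γ Δ X} → (∀ {Y} → Y ∈ Γ → Cl Δ Y) → X ∈ U → ¬ Cl Γ X → Cl Δ X →
              missing Δ < missing Γ
  missing-< Γ⊆ClΔ X∈U ¬ClΓX ClΔX =
    length-filter-mono-< (¬Cl? _) (¬Cl? _) (¬Cl-antitone Γ⊆ClΔ) X∈U (λ ¬ClΔX → ¬ClΔX ClΔX) ¬ClΓX

  -- The offset N + 1 pays for the irregular premise of L⊃, whose right formula may be larger than C.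
  rightWeight : Arrow → Formula → ℕ
  rightWeight reg C = suc (size C) + N
  rightWeight irr C = size C

  size≤rightWeight : ∀ a C → size C ≤ rightWeight a C
  size≤rightWeight reg C = ≤-trans (n≤1+n (size C)) (m≤m+n (suc (size C)) N)
  size≤rightWeight irr C = ≤-refl

  rightWeight-mono-< : ∀ a {A C} → size A < size C → rightWeight a A < rightWeight a C
  rightWeight-mono-< reg A<C = +-monoˡ-< N (s≤s A<C)
  rightWeight-mono-< irr A<C = A<C

  weight : Seq → ℕ
  weight s = sum (map leftSize (ant s)) + rightWeight (arr s) (rhs s)

  rank : Seq → ℕ
  rank s = weight s + suc (N + N) * missing (ant s)

  rank-<-by-weight : ∀ {p s} → missing (ant p) ≤ missing (ant s) → weight p < weight s → rank p < rank s
  rank-<-by-weight mp≤ms wp<ws = +-mono-<-≤ wp<ws (*-monoʳ-≤ (suc (N + N)) mp≤ms)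

  rank-<-by-missing : ∀ {p s} → missing (ant p) < missing (ant s) → weight p ≤ weight s + (N + N) →
                      rank p < rank s
  rank-<-by-missing {p} {s} mp<ms wp≤ = begin-strict
    weight p + K * mp            ≤⟨ +-monoˡ-≤ (K * mp) wp≤ ⟩
    weight s + (N + N) + K * mp  <⟨ +-monoˡ-< (K * mp) (+-monoʳ-< (weight s) ≤-refl) ⟩
    weight s + K + K * mp        ≡⟨ +-assoc (weight s) K (K * mp) ⟩
    weight s + (K + K * mp)      ≡⟨ cong (weight s +_) (*-suc K mp) ⟨
    weight s + K * suc mp        ≤⟨ +-monoʳ-≤ (weight s) (*-monoʳ-≤ K mp<ms) ⟩
    weight s + K * missing (ant s) ∎
    where
    open ≤-Reasoning
    K = suc (N + N)
    mp = missing (ant p)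

  infix 4 _≺_
  _≺_ : Seq → Seq → Set
  p ≺ s = AdmissibleSeq p × rank p < rank s

  principal-admissible : ∀ {Δ P Ψ} → Δ ≈ P ∷ Ψ → All Admissible Δ → Admissible P
  principal-admissible Δ≈PΨ okΔ = All.lookup okΔ (≈⇒⊇ Δ≈PΨ (here refl))

  ≺-same-antecedent : ∀ {Δ Δ′ C C′} a′ a → Δ′ ≈ Δ → Unique Δ′ → Admissible C′ →
                      rightWeight a′ C′ < rightWeight a C →
                      AdmissibleSeq (seq Δ a C) → seq Δ′ a′ C′ ≺ seq Δ a C
  ≺-same-antecedent {Δ} {Δ′} {C} {C′} a′ a Δ′≈Δ Δ′! okC′ C′<C (_ ∷ okΔ) =
    okC′ ∷ anti-mono (≈⇒⊆ Δ′≈Δ) okΔ ,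
    rank-<-by-weight {seq Δ′ a′ C′} {seq Δ a C} (missing-antitone (base ∘ ≈⇒⊇ Δ′≈Δ))
                     (+-mono-≤-< (sum-mono-⊆ leftSize Δ′! (≈⇒⊆ Δ′≈Δ)) C′<C)

  ≺-left-rule : ∀ {P Ψ Δ Δ′ C} Ys → P ∉ Ψ → Δ ≈ P ∷ Ψ → Δ′ ≈ Ys ++ Ψ → Unique Δ′ →
                All Admissible Ys → Cl Ys P → sum (map leftSize Ys) < leftSize P →
                AdmissibleSeq (seq Δ reg C) → seq Δ′ reg C ≺ seq Δ reg C
  ≺-left-rule {P} {Ψ} {Δ} {Δ′} {C} Ys P∉Ψ Δ≈PΨ Δ′≈YsΨ Δ′! okYs ClYsP Ys<P (okC ∷ okΔ) =
    okC ∷ anti-mono (≈⇒⊆ Δ′≈YsΨ) (++⁺ okYs (anti-mono Ψ⊆Δ okΔ)) ,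
    rank-<-by-weight {seq Δ′ reg C} {seq Δ reg C} (missing-antitone Δ⊆ClΔ′) (+-monoˡ-< (rightWeight reg C) leftWeight<)
    where
    P∈Δ = ≈⇒⊇ Δ≈PΨ (here refl)

    Ψ⊆Δ : Ψ ⊆ Δ
    Ψ⊆Δ = ≈⇒⊇ Δ≈PΨ ∘ there

    Δ⊆ClΔ′ : ∀ {X} → X ∈ Δ → Cl Δ′ X
    Δ⊆ClΔ′ X∈Δ with ≈⇒⊆ Δ≈PΨ X∈Δ
    ... | here refl = Cl-mono (base ∘ ≈⇒⊇ Δ′≈YsΨ ∘ ∈-++⁺ˡ) ClYsP
    ... | there X∈Ψ = base (≈⇒⊇ Δ′≈YsΨ (∈-++⁺ʳ Ys X∈Ψ))

    Δ′⊆Ys++Δ─P : Δ′ ⊆ Ys ++ (Δ ─ P∈Δ)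
    Δ′⊆Ys++Δ─P X∈Δ′ with ∈-++⁻ Ys (≈⇒⊆ Δ′≈YsΨ X∈Δ′)
    ... | inj₁ X∈Ys = ∈-++⁺ˡ X∈Ys
    ... | inj₂ X∈Ψ  = ∈-++⁺ʳ Ys (∈-─⁺ P∈Δ (Ψ⊆Δ X∈Ψ) λ { refl → P∉Ψ X∈Ψ })

    leftWeight< : sum (map leftSize Δ′) < sum (map leftSize Δ)
    leftWeight< = begin-strict
      sum (map leftSize Δ′)                                ≤⟨ sum-mono-⊆ leftSize Δ′! Δ′⊆Ys++Δ─P ⟩
      sum (map leftSize (Ys ++ Δ ─ P∈Δ))                   ≡⟨ cong sum (map-++ leftSize Ys (Δ ─ P∈Δ)) ⟩
      sum (map leftSize Ys ++ map leftSize (Δ ─ P∈Δ))      ≡⟨ sum-++ (map leftSize Ys) _ ⟩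
      sum (map leftSize Ys) + sum (map leftSize (Δ ─ P∈Δ)) <⟨ +-monoˡ-< _ Ys<P ⟩
      leftSize P + sum (map leftSize (Δ ─ P∈Δ))            ≡⟨ sum-map-─ leftSize P∈Δ ⟨
      sum (map leftSize Δ)                                 ∎
      where open ≤-Reasoning

  ≺-⊃R∉ : ∀ {Δ Δ′ A B} a → ¬ Cl Δ A → Δ′ ≈ A ∷ Δ → Unique Δ′ →
           AdmissibleSeq (seq Δ a (A ⊃ B)) → seq Δ′ reg B ≺ seq Δ a (A ⊃ B)
  ≺-⊃R∉ {Δ} {Δ′} {A} {B} a ¬ClΔA Δ′≈AΔ Δ′! (okA⊃B@((A∈U , _) , _) ∷ okΔ) =
    okB ∷ anti-mono (≈⇒⊆ Δ′≈AΔ) (okA ∷ okΔ) ,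
    rank-<-by-missing {seq Δ′ reg B} {seq Δ a (A ⊃ B)}
      (missing-< (base ∘ ≈⇒⊇ Δ′≈AΔ ∘ there) A∈U ¬ClΔA (base (≈⇒⊇ Δ′≈AΔ (here refl))))
      weight≤
    where
    okA = proj₁ (admissible-⊃ okA⊃B)
    okB = proj₂ (admissible-⊃ okA⊃B)
    L = sum (map leftSize Δ)
    R = rightWeight a (A ⊃ B)

    rearrange : ∀ n l r → (n + l) + (r + n) ≡ (l + r) + (n + n)
    rearrange = solve-∀

    weight≤ : weight (seq Δ′ reg B) ≤ weight (seq Δ a (A ⊃ B)) + (N + N)
    weight≤ = begin
      sum (map leftSize Δ′) + (suc (size B) + N)
        ≤⟨ +-mono-≤ (sum-mono-⊆ leftSize Δ′! (≈⇒⊆ Δ′≈AΔ))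
                    (+-monoˡ-≤ N (≤-trans (s≤s (m≤n+m (size B) (size A))) (size≤rightWeight a (A ⊃ B)))) ⟩
      (leftSize A + L) + (R + N)
        ≤⟨ +-monoˡ-≤ (R + N) (+-monoˡ-≤ L (≤-trans (leftSize≤size A) (proj₂ okA))) ⟩
      (N + L) + (R + N)
        ≡⟨ rearrange N L R ⟩
      (L + R) + (N + N) ∎
      where open ≤-Reasoning

  private
    singleton< : ∀ {X n} → leftSize X < n → sum (map leftSize (X ∷ [])) < n
    singleton< = ≤-<-trans (≤-reflexive (+-identityʳ _))

  rule-descends : ∀ {ps s} → Rule ps s → All (λ p → Unique (ant p)) ps → AdmissibleSeq s →
                  All (_≺ s) ps
  rule-descends (L∧ {A = A} {B} P∉Ψ Δ≈ Δ′≈) (Δ′! ∷ []) inv@(_ ∷ okΔ) =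
    let (okA , okB) = admissible-∧ (principal-admissible Δ≈ okΔ) in
    ≺-left-rule (A ∷ B ∷ []) P∉Ψ Δ≈ Δ′≈ Δ′! (okA ∷ okB ∷ [])
      (cl∧ (base (here refl)) (base (there (here refl))))
      (s≤s (≤-reflexive (cong (leftSize A +_) (+-identityʳ (leftSize B))))) inv ∷ []
  rule-descends (R∧ {A = A} {B} a Δ₁≈ Δ₂≈) (Δ₁! ∷ Δ₂! ∷ []) inv@(okA∧B ∷ _) =
    let (okA , okB) = admissible-∧ okA∧B in
    ≺-same-antecedent a a Δ₁≈ Δ₁! okA (rightWeight-mono-< a (s≤s (m≤m+n (size A) (size B)))) inv ∷
    ≺-same-antecedent a a Δ₂≈ Δ₂! okB (rightWeight-mono-< a (s≤s (m≤n+m (size B) (size A)))) inv ∷ []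
  rule-descends (L∨ {A = A} {B} P∉Ψ Δ≈ Δ₁≈ Δ₂≈) (Δ₁! ∷ Δ₂! ∷ []) inv@(_ ∷ okΔ) =
    let (okA , okB) = admissible-∨ (principal-admissible Δ≈ okΔ) in
    ≺-left-rule (A ∷ []) P∉Ψ Δ≈ Δ₁≈ Δ₁! (okA ∷ []) (cl∨ʳ B (base (here refl)))
      (singleton< (s≤s (m≤m+n (leftSize A) (leftSize B)))) inv ∷
    ≺-left-rule (B ∷ []) P∉Ψ Δ≈ Δ₂≈ Δ₂! (okB ∷ []) (cl∨ˡ A (base (here refl)))
      (singleton< (s≤s (m≤n+m (leftSize B) (leftSize A)))) inv ∷ []
  rule-descends (R∨₁ {C₁ = C₁} {C₂} a Δ′≈) (Δ′! ∷ []) inv@(okC ∷ _) =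
    ≺-same-antecedent irr a Δ′≈ Δ′! (proj₁ (admissible-∨ okC))
      (<-≤-trans (s≤s (m≤m+n (size C₁) (size C₂))) (size≤rightWeight a (C₁ ∨ C₂))) inv ∷ []
  rule-descends (R∨₂ {C₁ = C₁} {C₂} a Δ′≈) (Δ′! ∷ []) inv@(okC ∷ _) =
    ≺-same-antecedent irr a Δ′≈ Δ′! (proj₂ (admissible-∨ okC))
      (<-≤-trans (s≤s (m≤n+m (size C₂) (size C₁))) (size≤rightWeight a (C₁ ∨ C₂))) inv ∷ []
  rule-descends (L⊃ {A = A} {B} {C} P∉Ψ Δ≈ Δ₁≈ Δ₂≈) (Δ₁! ∷ Δ₂! ∷ []) inv@(_ ∷ okΔ) =
    let (okA , okB) = admissible-⊃ (principal-admissible Δ≈ okΔ) in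
    ≺-same-antecedent irr reg (≈-trans-sym Δ₁≈ Δ≈) Δ₁! okA (s≤s (≤-trans (proj₂ okA) (m≤n+m N (size C)))) inv ∷
    ≺-left-rule (B ∷ []) P∉Ψ Δ≈ Δ₂≈ Δ₂! (okB ∷ []) (cl⊃ A (base (here refl))) (singleton< ≤-refl) inv ∷ []
  rule-descends (⊃R∈ {A = A} {B} a _ Δ′≈) (Δ′! ∷ []) inv@(okA⊃B ∷ _) =
    ≺-same-antecedent a a Δ′≈ Δ′! (proj₂ (admissible-⊃ okA⊃B))
      (rightWeight-mono-< a (s≤s (m≤n+m (size B) (size A)))) inv ∷ []
  rule-descends (⊃R∉ a ¬ClΔA Δ′≈) (Δ′! ∷ []) inv = ≺-⊃R∉ a ¬ClΔA Δ′≈ Δ′! inv ∷ []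

  weight-bound : ∀ s → ∣ s ∣ ≤ N → weight s ≤ suc (N + N)
  weight-bound (seq Ψ a C) τ≤N = begin
    sum (map leftSize Ψ) + rightWeight a C    ≤⟨ +-mono-≤ (sum-leftSize≤sum-size Ψ) (rightWeight≤reg a) ⟩
    sum (map size Ψ) + suc (size C + N)      ≡⟨ +-suc (sum (map size Ψ)) (size C + N) ⟩
    suc (sum (map size Ψ) + (size C + N))    ≡⟨ cong suc (+-assoc (sum (map size Ψ)) (size C) N) ⟨
    suc (∣ seq Ψ a C ∣ + N)                  ≤⟨ s≤s (+-monoˡ-≤ N τ≤N) ⟩
    suc (N + N)                              ∎
    where
    open ≤-Reasoning
    rightWeight≤reg : ∀ a → rightWeight a C ≤ rightWeight reg C
    rightWeight≤reg reg = ≤-refl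
    rightWeight≤reg irr = size≤rightWeight reg C

  rank-bound : ∀ s → length U ≤ N → ∣ s ∣ ≤ N → rank s ≤ suc (N + N) * suc N
  rank-bound s U≤N τ≤N = begin
    weight s + K * missing (ant s) ≤⟨ +-mono-≤ (weight-bound s τ≤N) (*-monoʳ-≤ K missing≤N) ⟩
    K + K * N                      ≡⟨ *-suc K N ⟨
    K * suc N                      ∎
    where
    open ≤-Reasoning
    K = suc (N + N)
    missing≤N = ≤-trans (length-filter (¬Cl? (ant s)) U) U≤N

∣∣≡sum-size : ∀ τ → ∣ τ ∣ ≡ sum (map size (rhs τ ∷ ant τ))
∣∣≡sum-size τ = +-comm (sum (map size (ant τ))) (size (rhs τ))

module _ (τ : Seq) where

  open Ranking (concatMap antecedents (rhs τ ∷ ant τ)) ∣ τ ∣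

  root-admissible : AdmissibleSeq τ
  root-admissible = All.tabulate λ {F} F∈τ →
    AntecedentsIn-mono (λ X∈F → ∈-concatMap⁺ antecedents (Any.map (λ { refl → X∈F }) F∈τ)) F (AntecedentsIn-antecedents F) ,
    ≤-trans (∈⇒≤sum-map size F∈τ) (≤-reflexive (sym (∣∣≡sum-size τ)))

  height-bound : ∀ {G} (T : Tree G τ) → height T ≤ suc (∣ τ ∣ + ∣ τ ∣) * suc ∣ τ ∣
  height-bound T = ≤-trans
    (height≤rank AdmissibleSeq rank (λ r → rule-descends r ∘ All.map proj₁) T root-admissible)
    (rank-bound τ (≤-trans (length-concatMap-antecedents (rhs τ ∷ ant τ)) (≤-reflexive (sym (∣∣≡sum-size τ))))
                ≤-refl)

quadratic-bound : ∀ n → suc (n + n) * suc n ≤ 5 * n ^ 2 + 5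
quadratic-bound n = begin
  suc (n + n) * suc n            ≡⟨ expand n ⟩
  2 * (n * n) + 3 * n + 1        ≤⟨ +-monoˡ-≤ 1 (+-monoʳ-≤ (2 * (n * n)) (*-monoʳ-≤ 3 (m≤m*m n))) ⟩
  2 * (n * n) + 3 * (n * n) + 1  ≡⟨ collect n ⟩
  5 * n ^ 2 + 1                  ≤⟨ +-monoʳ-≤ (5 * n ^ 2) (s≤s z≤n) ⟩
  5 * n ^ 2 + 5                  ∎
  where
  open ≤-Reasoning
  expand : ∀ m → (1 + (m + m)) * (1 + m) ≡ 2 * (m * m) + 3 * m + 1
  expand = solve-∀
  collect : ∀ m → 2 * (m * m) + 3 * (m * m) + 1 ≡ 5 * (m * (m * 1)) + 1
  collect = solve-∀
  m≤m*m : ∀ m → m ≤ m * m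
  m≤m*m zero      = z≤n
  m≤m*m m@(suc _) = m≤m*n m m

theorem5p4 : ∃[ c ] ((G : Formula) (τ : Seq) (T : Tree G τ) →
               height T ≤ c * (∣ τ ∣ ^ 2) + c)
theorem5p4 = 5 , λ G τ T → ≤-trans (height-bound τ T) (quadratic-bound ∣ τ ∣)
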